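{- Let $G=(V,E)$ be a connected graph with at least one edge. Then $\displaystyle \chi_i(G) \geq \frac{2|E|}{|V| - \gamma(G)}$.
   Context: $\gamma(G)$ denotes the domination number of $G$: the minimum size of a set $S\subseteq V$ such that every vertex not in $S$ has a neighbor in $S$. For a graph $G$, let $D(G)$ be the digraph obtained by replacing each edge $uv$ by the two opposite arcs $uv$ and $vu$, with arc set $A(G)$. Two distinct arcs $uv$ and $xy$ are adjacent if $u=x$, or $v=x$, or $y=u$. An incidence coloring is a map $\sigma: A(G)\to C$ assigning distinct colors to adjacent arcs; the incidence chromatic number $\chi_i(G)$ is the minimum $|C|$ over all incidence colorings. -}

module Defs where

open import Data.Nat using (ℕ; zero; suc; _+_; _*_; _∸_; _≤_; _<ᵇ_)
open import Data.Bool using (Bool; true; false; if_then_else_)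
open import Data.Fin using (Fin; zero; suc; toℕ)
open import Data.Fin.Subset using (Subset; _∈_; _∉_; ∣_∣)
open import Data.Product using (Σ; ∃; ∃-syntax; _×_; _,_)
open import Data.Sum using (_⊎_)
open import Relation.Binary.PropositionalEquality using (_≡_; _≢_)
open import Relation.Nullary using (¬_)

record Graph (n : ℕ) : Set where
  field
    adj   : Fin n → Fin n → Bool
    sym   : ∀ u v → adj u v ≡ adj v u
    irrefl : ∀ v → adj v v ≡ false
open Graph public

Adj : ∀ {n} → Graph n → Fin n → Fin n → Set
Adj G u v = adj G u v ≡ true

sumFin : ∀ {n} → (Fin n → ℕ) → ℕ
sumFin {zero} f = 0
sumFin {suc n} f = f zero + sumFin (λ i → f (suc i))

-- Number of arcs of D(G) = number of ordered pairs (u,v) with uv ∈ E.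
-- This equals 2|E|.
arcCount : ∀ {n} → Graph n → ℕ
arcCount G = sumFin (λ u → sumFin (λ v → if adj G u v then 1 else 0))

edgeCount : ∀ {n} → Graph n → ℕ
edgeCount {n} G = sumFin (λ u → sumFin (λ v → if (toℕ u <ᵇ toℕ v) then (if adj G u v then 1 else 0) else 0))

data Reach {n} (G : Graph n) : Fin n → Fin n → Set where
  here : ∀ {u} → Reach G u u
  step : ∀ {u v w} → Adj G u v → Reach G v w → Reach G u w

Connected : ∀ {n} → Graph n → Set
Connected G = ∀ u v → Reach G u v

HasEdge : ∀ {n} → Graph n → Set
HasEdge G = ∃[ u ] ∃[ v ] Adj G u v

IsDominatingSet : ∀ {n} → Graph n → Subset n → Set
IsDominatingSet G S = ∀ v → v ∉ S → ∃[ u ] (u ∈ S × Adj G u v)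

IsDominationNumber : ∀ {n} → Graph n → ℕ → Set
IsDominationNumber G g =
  (∃[ S ] (IsDominatingSet G S × ∣ S ∣ ≡ g)) ×
  (∀ S → IsDominatingSet G S → g ≤ ∣ S ∣)

Arc : ∀ {n} → Graph n → Set
Arc {n} G = Σ (Fin n × Fin n) (λ { (u , v) → Adj G u v })

ArcAdjacent : ∀ {n} {G : Graph n} → Arc G → Arc G → Set
ArcAdjacent ((u , v) , _) ((x , y) , _) = (u ≡ x) ⊎ (v ≡ x) ⊎ (y ≡ u)

DistinctArcs : ∀ {n} {G : Graph n} → Arc G → Arc G → Set
DistinctArcs ((u , v) , _) ((x , y) , _) = ¬ ((u ≡ x) × (v ≡ y))

IsIncidenceColoring : ∀ {n} (G : Graph n) (k : ℕ) → (Arc G → Fin k) → Set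
IsIncidenceColoring G k σ =
  ∀ a b → DistinctArcs {G = G} a b → ArcAdjacent {G = G} a b → σ a ≢ σ b

HasIncidenceColoring : ∀ {n} → Graph n → ℕ → Set
HasIncidenceColoring G k = ∃[ σ ] IsIncidenceColoring G k σ

IsIncidenceChromaticNumber : ∀ {n} → Graph n → ℕ → Set
IsIncidenceChromaticNumber G c =
  HasIncidenceColoring G c × (∀ k → HasIncidenceColoring G k → c ≤ k)

-- For a colour i, let Tᵢ be the set of tails of the arcs coloured i. Two arcs coloured i
-- never share a tail, and never meet head-to-tail, since both configurations are adjacent
-- arcs. So colour i is used on exactly |Tᵢ| arcs, and the head of each of them lies outside
-- Tᵢ: the complement of Tᵢ is a dominating set, whence |Tᵢ| ≤ |V| − γ(G). Summing over the
-- χᵢ(G) colours bounds the 2|E| arcs of D(G).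
module Submission where

open import Defs hiding (sym)
open import Axiom.UniquenessOfIdentityProofs using (module Decidable⇒UIP)
open import Data.Bool.Base using (Bool; true; false; if_then_else_; T)
import Data.Bool.Properties as Bool
open import Data.Empty using (⊥-elim)
open import Data.Fin.Base using (Fin; zero; suc; toℕ)
open import Data.Fin.Properties using (any?) renaming (_≟_ to _≟ᶠ_)
import Data.Fin.Properties as Fin
open import Data.Fin.Subset using (Subset; _∈_; ∣_∣; ∁)
open import Data.Fin.Subset.Properties using (∣∁p∣≡n∸∣p∣; ∣p∣≤n; x∉∁p⇒x∈p; x∉p⇒x∈∁p)
open import Data.Nat.Base using (ℕ; zero; suc; _+_; _*_; _∸_; _≤_; _<ᵇ_; z≤n)
open import Data.Nat.Properties
open import Algebra.Properties.CommutativeMonoid.Sum +-0-commutativeMonoid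
  using (sum; sum-cong-≗; sum-remove; sum-replicate-zero; ∑-comm; ∑-distrib-+)
open import Data.Product using (Σ; ∃-syntax; _,_; proj₂)
open import Data.Sum.Base using (inj₁; inj₂)
open import Data.Vec.Base using (tabulate)
open import Data.Vec.Properties using (lookup∘tabulate; []=⇒lookup)
open import Function.Base using (_∘_; case_of_)
open import Relation.Nullary using (¬_; yes; no; does)
open import Relation.Nullary.Decidable using (dec-true; dec-false)
open import Relation.Unary using (Pred; Decidable)
open import Relation.Binary.PropositionalEquality

sumFin≡sum : ∀ {n} (f : Fin n → ℕ) → sumFin f ≡ sum f
sumFin≡sum {zero}  f = refl
sumFin≡sum {suc n} f = cong (f zero +_) (sumFin≡sum (f ∘ suc))

sumFin²≡sum² : ∀ {m n} (f : Fin m → Fin n → ℕ) →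
               sumFin (λ i → sumFin (f i)) ≡ sum (λ i → sum (f i))
sumFin²≡sum² f = trans (sumFin≡sum (λ i → sumFin (f i))) (sum-cong-≗ (λ i → sumFin≡sum (f i)))

sum-mono-≤ : ∀ {n} {f g : Fin n → ℕ} → (∀ i → f i ≤ g i) → sum f ≤ sum g
sum-mono-≤ {zero}  f≤g = z≤n
sum-mono-≤ {suc n} f≤g = +-mono-≤ (f≤g zero) (sum-mono-≤ (f≤g ∘ suc))

≤-sum : ∀ {n} (f : Fin n → ℕ) i → f i ≤ sum f
≤-sum {suc n} f i = ≤-trans (m≤m+n (f i) _) (≤-reflexive (sym (sum-remove {i = i} f)))

sum-≤-* : ∀ {n k} {f : Fin n → ℕ} → (∀ i → f i ≤ k) → sum f ≤ n * k
sum-≤-* {zero}  f≤k = z≤n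
sum-≤-* {suc n} f≤k = +-mono-≤ (f≤k zero) (sum-≤-* (f≤k ∘ suc))

𝟙 : Bool → ℕ
𝟙 b = if b then 1 else 0

𝟙≤ : ∀ {b x} → (b ≡ true → 1 ≤ x) → 𝟙 b ≤ x
𝟙≤ {false} _   = z≤n
𝟙≤ {true}  1≤x = 1≤x refl

sum-𝟙-∄ : ∀ {n p} {P : Pred (Fin n) p} (P? : Decidable P) →
          (∀ i → ¬ P i) → sum (λ i → 𝟙 (does (P? i))) ≡ 0
sum-𝟙-∄ {n} P? ∄P = trans (sum-cong-≗ (λ i → cong 𝟙 (dec-false (P? i) (∄P i))))
                          (sum-replicate-zero n)

sum-𝟙-≤1 : ∀ {n p} {P : Pred (Fin n) p} (P? : Decidable P) →
           (∀ {i j} → P i → P j → i ≡ j) → sum (λ i → 𝟙 (does (P? i))) ≤ 1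
sum-𝟙-≤1 {zero}  P? unique = z≤n
sum-𝟙-≤1 {suc n} P? unique with P? zero
... | yes p = ≤-reflexive (cong suc (sum-𝟙-∄ (P? ∘ suc) (λ i q → Fin.0≢1+n (unique p q))))
... | no _  = sum-𝟙-≤1 (P? ∘ suc) (λ p q → Fin.suc-injective (unique p q))

sum-𝟙-unique : ∀ {n p} {P : Pred (Fin n) p} (P? : Decidable P) →
               (∀ {i j} → P i → P j → i ≡ j) →
               sum (λ i → 𝟙 (does (P? i))) ≤ 𝟙 (does (any? P?))
sum-𝟙-unique P? unique with any? P?
... | yes _ = sum-𝟙-≤1 P? unique
... | no ∄P = ≤-reflexive (sum-𝟙-∄ P? (λ i p → ∄P (i , p)))

∈-tabulate⁻ : ∀ {n} (b : Fin n → Bool) {i} → i ∈ tabulate b → b i ≡ true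
∈-tabulate⁻ b {i} i∈ = trans (sym (lookup∘tabulate b i)) ([]=⇒lookup i∈)

∣tabulate∣≡sum-𝟙 : ∀ {n} (b : Fin n → Bool) → ∣ tabulate b ∣ ≡ sum (𝟙 ∘ b)
∣tabulate∣≡sum-𝟙 {zero}  b = refl
∣tabulate∣≡sum-𝟙 {suc n} b with b zero
... | true  = cong suc (∣tabulate∣≡sum-𝟙 (b ∘ suc))
... | false = ∣tabulate∣≡sum-𝟙 (b ∘ suc)

m≤o⇒n≤o∸m⇒m≤o∸n : ∀ {m n o} → m ≤ o → n ≤ o ∸ m → m ≤ o ∸ n
m≤o⇒n≤o∸m⇒m≤o∸n {m} {n} {o} m≤o n≤o∸m =
  m+n≤o⇒m≤o∸n m (subst (_≤ o) (+-comm n m) (m≤o∸n⇒m+n≤o n m≤o n≤o∸m))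

if<ᵇ+if>ᵇ≤ : ∀ x y a → (if x <ᵇ y then a else 0) + (if y <ᵇ x then a else 0) ≤ a
if<ᵇ+if>ᵇ≤ x y a with x <ᵇ y in x<y | y <ᵇ x in y<x
... | true  | true  = ⊥-elim (<-asym (<ᵇ⇒< x y (subst T (sym x<y) _)) (<ᵇ⇒< y x (subst T (sym y<x) _)))
... | true  | false = ≤-reflexive (+-identityʳ a)
... | false | true  = ≤-refl
... | false | false = z≤n

module _ {n} (G : Graph n) where

  Adj-irrefl : ∀ {v} → ¬ Adj G v v
  Adj-irrefl {v} vv = case trans (sym vv) (Graph.irrefl G v) of λ ()

  arcCount≡sum : arcCount G ≡ sum (λ u → sum (λ v → 𝟙 (adj G u v)))
  arcCount≡sum = sumFin²≡sum² (λ u v → 𝟙 (adj G u v))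

  2*edgeCount≤arcCount : 2 * edgeCount G ≤ arcCount G
  2*edgeCount≤arcCount = begin
    2 * edgeCount G                          ≡⟨ cong (2 *_) (sumFin²≡sum² lower) ⟩
    2 * E                                    ≡⟨ cong (E +_) (+-identityʳ E) ⟩
    E + E                                    ≡⟨ cong (E +_) E≡E′ ⟩
    E + sum (λ u → sum (upper u))            ≡⟨ sym (∑-distrib-+ (λ u → sum (lower u)) _) ⟩
    sum (λ u → sum (lower u) + sum (upper u)) ≡⟨ sum-cong-≗ (λ u → sym (∑-distrib-+ (lower u) (upper u))) ⟩
    sum (λ u → sum (λ v → lower u v + upper u v))
      ≤⟨ sum-mono-≤ (λ u → sum-mono-≤ (λ v → if<ᵇ+if>ᵇ≤ (toℕ u) (toℕ v) (𝟙 (adj G u v)))) ⟩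
    sum (λ u → sum (λ v → 𝟙 (adj G u v)))    ≡⟨ sym arcCount≡sum ⟩
    arcCount G                               ∎
    where
    open ≤-Reasoning
    lower upper : Fin n → Fin n → ℕ
    lower u v = if toℕ u <ᵇ toℕ v then 𝟙 (adj G u v) else 0
    upper u v = if toℕ v <ᵇ toℕ u then 𝟙 (adj G u v) else 0
    E : ℕ
    E = sum (λ u → sum (lower u))
    E≡E′ : E ≡ sum (λ u → sum (upper u))
    E≡E′ = trans (∑-comm lower) (sum-cong-≗ (λ u → sum-cong-≗ (λ v →
             cong (λ b → if toℕ v <ᵇ toℕ u then 𝟙 b else 0) (Graph.sym G v u))))

module ColourClasses {n k} (G : Graph n) {σ : Arc G → Fin k}
                     (proper : IsIncidenceColoring G k σ) where

  Coloured : Fin k → Fin n → Fin n → Set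
  Coloured i u v = Σ (Adj G u v) λ uv → σ ((u , v) , uv) ≡ i

  coloured? : ∀ i u → Decidable (Coloured i u)
  coloured? i u v with adj G u v Bool.≟ true
  ... | no ¬uv = no (λ (uv , _) → ¬uv uv)
  ... | yes uv with σ ((u , v) , uv) ≟ᶠ i
  ...   | yes σuv≡i = yes (uv , σuv≡i)
  ...   | no σuv≢i  = no λ (uv′ , σuv′≡i) →
            σuv≢i (subst (λ e → σ ((u , v) , e) ≡ i) (Decidable⇒UIP.≡-irrelevant Bool._≟_ uv′ uv) σuv′≡i)

  𝟙coloured : Fin k → Fin n → Fin n → ℕ
  𝟙coloured i u v = 𝟙 (does (coloured? i u v))

  out-arc-unique : ∀ {i u v w} → Coloured i u v → Coloured i u w → v ≡ w
  out-arc-unique {v = v} {w} (uv , σuv≡i) (uw , σuw≡i) with v ≟ᶠ w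
  ... | yes v≡w = v≡w
  ... | no v≢w  = ⊥-elim (proper (_ , uv) (_ , uw) (λ (_ , v≡w) → v≢w v≡w) (inj₁ refl)
                                 (trans σuv≡i (sym σuw≡i)))

  head-has-no-out-arc : ∀ {i u v w} → Coloured i u v → ¬ Coloured i v w
  head-has-no-out-arc {u = u} (uv , σuv≡i) (vw , σvw≡i) =
    proper (_ , uv) (_ , vw) (λ (u≡v , _) → Adj-irrefl G (subst (Adj G u) (sym u≡v) uv))
           (inj₂ (inj₁ refl)) (trans σuv≡i (sym σvw≡i))

  hasOutArc? : ∀ i → Decidable (λ u → ∃[ v ] Coloured i u v)
  hasOutArc? i u = any? (coloured? i u)

  Tails : Fin k → Subset n
  Tails i = tabulate (λ u → does (hasOutArc? i u))

  ∈Tails⇒out-arc : ∀ {i u} → u ∈ Tails i → ∃[ v ] Coloured i u v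
  ∈Tails⇒out-arc {i} {u} u∈ with hasOutArc? i u | ∈-tabulate⁻ (does ∘ hasOutArc? i) u∈
  ... | yes out | refl = out

  ∁Tails-dominating : ∀ i → IsDominatingSet G (∁ (Tails i))
  ∁Tails-dominating i v v∉ with ∈Tails⇒out-arc (x∉∁p⇒x∈p v∉)
  ... | w , vw@(v~w , _) = w , w∈∁Tails , trans (Graph.sym G w v) v~w
    where
    w∈∁Tails : w ∈ ∁ (Tails i)
    w∈∁Tails = x∉p⇒x∈∁p λ w∈ → head-has-no-out-arc vw (proj₂ (∈Tails⇒out-arc w∈))

  colour-class-≤-∣Tails∣ : ∀ i → sum (λ u → sum (𝟙coloured i u)) ≤ ∣ Tails i ∣
  colour-class-≤-∣Tails∣ i = begin
    sum (λ u → sum (𝟙coloured i u))                    ≤⟨ sum-mono-≤ (λ u → sum-𝟙-unique (coloured? i u) out-arc-unique) ⟩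
    sum (λ u → 𝟙 (does (hasOutArc? i u)))             ≡⟨ sym (∣tabulate∣≡sum-𝟙 (does ∘ hasOutArc? i)) ⟩
    ∣ Tails i ∣                                        ∎
    where open ≤-Reasoning

  𝟙-adj≤sum-colours : ∀ u v → 𝟙 (adj G u v) ≤ sum (λ i → 𝟙coloured i u v)
  𝟙-adj≤sum-colours u v = 𝟙≤ λ uv →
    subst (_≤ sum (λ i → 𝟙coloured i u v))
          (cong 𝟙 (dec-true (coloured? (σ ((u , v) , uv)) u v) (uv , refl)))
          (≤-sum (λ i → 𝟙coloured i u v) (σ ((u , v) , uv)))

  arcCount≤sum-∣Tails∣ : arcCount G ≤ sum (λ i → ∣ Tails i ∣)
  arcCount≤sum-∣Tails∣ = begin
    arcCount G                                                   ≡⟨ arcCount≡sum G ⟩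
    sum (λ u → sum (λ v → 𝟙 (adj G u v)))                        ≤⟨ sum-mono-≤ (λ u → sum-mono-≤ (𝟙-adj≤sum-colours u)) ⟩
    sum (λ u → sum (λ v → sum (λ i → 𝟙coloured i u v)))          ≡⟨ sum-cong-≗ (λ u → ∑-comm (λ v i → 𝟙coloured i u v)) ⟩
    sum (λ u → sum (λ i → sum (𝟙coloured i u)))                  ≡⟨ ∑-comm (λ u i → sum (𝟙coloured i u)) ⟩
    sum (λ i → sum (λ u → sum (𝟙coloured i u)))                  ≤⟨ sum-mono-≤ colour-class-≤-∣Tails∣ ⟩
    sum (λ i → ∣ Tails i ∣)                                      ∎
    where open ≤-Reasoning

  ∣Tails∣≤n∸γ : ∀ {g} → (∀ S → IsDominatingSet G S → g ≤ ∣ S ∣) → ∀ i → ∣ Tails i ∣ ≤ n ∸ g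
  ∣Tails∣≤n∸γ minimal i = m≤o⇒n≤o∸m⇒m≤o∸n (∣p∣≤n (Tails i))
    (subst (_ ≤_) (∣∁p∣≡n∸∣p∣ (Tails i)) (minimal (∁ (Tails i)) (∁Tails-dominating i)))

-- Connectivity and the existing edge only ensure n ∸ g > 0, which the multiplied-out form does not need.
proposition3p1 : ∀ (n : ℕ) (G : Graph n) → Connected G → HasEdge G →
    ∀ (g c : ℕ) → IsDominationNumber G g → IsIncidenceChromaticNumber G c →
    2 * edgeCount G ≤ c * (n ∸ g)
proposition3p1 n G _ _ g c (_ , minimal) ((σ , proper) , _) = begin
  2 * edgeCount G           ≤⟨ 2*edgeCount≤arcCount G ⟩
  arcCount G                ≤⟨ arcCount≤sum-∣Tails∣ ⟩
  sum (λ i → ∣ Tails i ∣)   ≤⟨ sum-≤-* (∣Tails∣≤n∸γ minimal) ⟩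
  c * (n ∸ g)               ∎
  where
  open ≤-Reasoning
  open ColourClasses G proper
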